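{- Let $n\ge2$ and $\pi\in\mathfrak{S}_n(3124,42153,24153)$. Then the word $w_\pi$ has no subword (not necessarily consecutive) of the form $\mathrm{L}\mathrm{R}\mathrm{L}\mathrm{R}$. Consequently $\mathsf{alt}(\pi)\le 4$, and if $\pi^{ -1}_2<\pi^{ -1}_1$ then $\mathsf{alt}(\pi)\le 3$. (Also $\mathsf{alt}(\pi)\le4$ trivially for $n=1$.)
   Context: $\mathfrak{S}_n(P_1,\dots,P_r)$ is the set of permutations of $[n]$ (one-line notation) avoiding each pattern $P_i$ (no subsequence order isomorphic to $P_i$). For $\pi\in\mathfrak{S}_{n}$ with $n\ge2$ and $\pi_k=1$, define the word $w_\pi=w_1\cdots w_{n-1}$ over $\{\mathrm{L},\mathrm{R}\}$ by $w_i=\mathrm{L}$ if $\pi_j=i+1$ for some $j<k$ and $w_i=\mathrm{R}$ if $\pi_j=i+1$ for some $j>k$. For a word $w$ over $\{\mathrm{L},\mathrm{R}\}$, $\mathsf{alt}(w)$ is the maximum length of a subword (subsequence) of $w$ with no two consecutive equal letters. Set $\mathsf{alt}(\pi)=\mathsf{alt}(w_\pi)$ for $n\ge2$ and $\mathsf{alt}(\pi)=0$ for $n=1$. $\pi^{ -1}_i$ denotes the position of $i$ in $\pi$. -}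

module Defs where

open import Data.Nat.Base using (ℕ; zero; suc; _≤_; _<ᵇ_)
open import Data.Fin.Base using (Fin; toℕ; _<_) renaming (zero to fz; suc to fs)
open import Data.Fin.Permutation using (Permutation′; _⟨$⟩ʳ_; _⟨$⟩ˡ_)
open import Data.Vec.Base using (Vec; lookup; tabulate; toList; _∷_; [])
open import Data.List.Base using (List; []; _∷_; map; _++_; length; foldr; filterᵇ)
open import Data.Nat.Base using (_⊔_)
open import Data.Product.Base using (Σ; _×_)
open import Function.Bundles using (_⇔_)
open import Data.Bool.Base using (Bool; true; false)
open import Data.List.Membership.Propositional using (_∈_)
open import Relation.Nullary using (¬_)

-- Permutations of [n] are bijections Fin n ↔ Fin n (stdlib Permutation′).
-- Values are 0-indexed: value v (Fin) stands for v+1 in the paper.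

Contains : ∀ {n k} → Permutation′ n → Vec (Fin k) k → Set
Contains {n} {k} π P =
  Σ (Fin k → Fin n) λ f →
    (∀ i j → i < j → f i < f j) ×
    (∀ i j → (lookup P i < lookup P j) ⇔ ((π ⟨$⟩ʳ f i) < (π ⟨$⟩ʳ f j)))

Avoids : ∀ {n k} → Permutation′ n → Vec (Fin k) k → Set
Avoids π P = ¬ Contains π P

p3124 : Vec (Fin 4) 4
p3124 = fs (fs fz) ∷ fz ∷ fs fz ∷ fs (fs (fs fz)) ∷ []

p42153 : Vec (Fin 5) 5
p42153 = fs (fs (fs fz)) ∷ fs fz ∷ fz ∷ fs (fs (fs (fs fz))) ∷ fs (fs fz) ∷ []

p24153 : Vec (Fin 5) 5
p24153 = fs fz ∷ fs (fs (fs fz)) ∷ fz ∷ fs (fs (fs (fs fz))) ∷ fs (fs fz) ∷ []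

data Letter : Set where
  L R : Letter

-- w_π for π ∈ S_{m+1}: letter i (i = 1..m, i.e. paper's value i+1) is L
-- iff the position of value i+1 is left of the position of value 1.
letterAt : ∀ {n} → Fin n → Fin n → Letter
letterAt p k with toℕ p <ᵇ toℕ k
... | true = L
... | false = R

word : ∀ {m} → Permutation′ (suc m) → List Letter
word {m} π = toList (tabulate {n = m} λ i → letterAt (π ⟨$⟩ˡ fs i) (π ⟨$⟩ˡ fz))

subwords : ∀ {A : Set} → List A → List (List A)
subwords [] = [] ∷ []
subwords (x ∷ xs) = let s = subwords xs in map (x ∷_) s ++ s

IsSubword : ∀ {A : Set} → List A → List A → Set
IsSubword u w = u ∈ subwords w

noRepeat? : List Letter → Bool
noRepeat? [] = true
noRepeat? (x ∷ []) = true
noRepeat? (L ∷ L ∷ xs) = false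
noRepeat? (R ∷ R ∷ xs) = false
noRepeat? (L ∷ R ∷ xs) = noRepeat? (R ∷ xs)
noRepeat? (R ∷ L ∷ xs) = noRepeat? (L ∷ xs)

altW : List Letter → ℕ
altW w = foldr _⊔_ 0 (map length (filterᵇ noRepeat? (subwords w)))

alt : ∀ {n} → Permutation′ n → ℕ
alt {zero} π = 0
alt {suc zero} π = 0
alt {suc (suc m)} π = altW (word π)

{-# OPTIONS --safe #-}

-- An LRLR in w_π gives values 1 < a < b < c < d with a, c to the left of 1 and
-- b, d to its right. If b precedes d, then c 1 b d is an occurrence of 3124;
-- otherwise a c 1 d b or c a 1 d b is an occurrence of 24153 or 42153. So w_π
-- has no subword LRLR, hence no alternating subword of length 5. When 2
-- precedes 1, w_π starts with L, and an alternating subword of length 4 is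
-- either LRLR itself or starts with R and can be preceded by that first L.

module Submission where

open import Defs
open import Data.Nat.Base using (ℕ; suc; _≤_)
open import Data.Fin.Base using (_<_) renaming (zero to fz; suc to fs)
open import Data.Fin.Permutation using (Permutation′; _⟨$⟩ˡ_)
open import Data.List.Base using (_∷_; [])
open import Data.Product.Base using (_×_)
open import Relation.Nullary using (¬_)
open import Relation.Nullary.Decidable using (T?)
open import Relation.Nullary.Reflects using (ofʸ; ofⁿ)

open import Data.Bool.Base using (T; true; false)
open import Data.Empty using (⊥-elim)
open import Data.Fin.Base using (Fin; toℕ)
open import Data.Fin.Patterns using (0F; 1F; 2F; 3F)
import Data.Fin.Properties as Fin
open import Data.Fin.Permutation using (_⟨$⟩ʳ_; inverseʳ)
open import Data.List.Base as List using (List; length; map)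
open import Data.List.Membership.Propositional using (_∈_)
open import Data.List.Membership.Propositional.Properties using (∈-++⁻; ∈-map⁻; ∈-filter⁻)
open import Data.List.Relation.Binary.Sublist.Propositional
  using (_⊆_; []; _∷_; _∷ʳ_; ⊆-trans; minimum)
open import Data.List.Relation.Unary.All using (tabulate)
import Data.List.Relation.Unary.All.Properties as All
open import Data.List.Relation.Unary.Any using (here)
open import Data.List.Properties using (foldr-preservesᵇ)
open import Data.Nat.Base as ℕ using (zero; z≤n; s≤s; _<ᵇ_)
import Data.Nat.Properties as ℕ
open import Data.Product.Base using (Σ; _,_)
open import Data.Sum.Base using (_⊎_; inj₁; inj₂; [_,_])
open import Data.Vec.Base as Vec using (Vec; lookup; _∷_; [])
open import Data.Vec.Properties using (lookup-map)
open import Data.Vec.Relation.Unary.Linked using (Linked; [-]; _∷_)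
open import Data.Vec.Relation.Unary.Linked.Properties using (lookup⁺)
open import Function.Base using (_on_; _∘_)
open import Function.Bundles using (_⇔_; mk⇔)
open import Relation.Binary.Definitions using (tri<; tri≈; tri>)
open import Relation.Binary.PropositionalEquality
  using (_≡_; refl; sym; trans; cong)

Alternating : List Letter → Set
Alternating u = T (noRepeat? u)

LRLR : List Letter
LRLR = L ∷ R ∷ L ∷ R ∷ []

∈-subwords⇒⊆ : ∀ {A : Set} (w : List A) {u} → u ∈ subwords w → u ⊆ w
∈-subwords⇒⊆ [] (here refl) = []
∈-subwords⇒⊆ (x ∷ w) u∈ with ∈-++⁻ (map (x ∷_) (subwords w)) u∈
... | inj₁ u∈x∷ with ∈-map⁻ (x ∷_) u∈x∷
...   | _ , u′∈ , refl = refl ∷ ∈-subwords⇒⊆ w u′∈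
∈-subwords⇒⊆ (x ∷ w) u∈ | inj₂ u∈′ = x ∷ʳ ∈-subwords⇒⊆ w u∈′

altW-≤ : ∀ {w k} → (∀ {u} → u ⊆ w → Alternating u → length u ≤ k) → altW w ≤ k
altW-≤ {w} {k} bound = foldr-preservesᵇ {P = _≤ k} ℕ.⊔-lub z≤n (All.map⁺ (tabulate λ u∈ →
  let u∈subwords , alternating = ∈-filter⁻ (λ u → T? (noRepeat? u)) u∈
  in bound (∈-subwords⇒⊆ w u∈subwords) alternating))

LRLR⊆alternating : ∀ u → Alternating u → 5 ≤ length u → LRLR ⊆ u
LRLR⊆alternating (L ∷ R ∷ L ∷ R ∷ u) _ _ = refl ∷ refl ∷ refl ∷ refl ∷ minimum u
LRLR⊆alternating (R ∷ L ∷ R ∷ L ∷ R ∷ u) _ _ = R ∷ʳ refl ∷ refl ∷ refl ∷ refl ∷ minimum u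
LRLR⊆alternating (L ∷ L ∷ _) () _
LRLR⊆alternating (R ∷ R ∷ _) () _
LRLR⊆alternating (L ∷ R ∷ R ∷ _) () _
LRLR⊆alternating (R ∷ L ∷ L ∷ _) () _
LRLR⊆alternating (L ∷ R ∷ L ∷ L ∷ _) () _
LRLR⊆alternating (R ∷ L ∷ R ∷ R ∷ _) () _
LRLR⊆alternating (R ∷ L ∷ R ∷ L ∷ L ∷ _) () _
LRLR⊆alternating [] _ ()
LRLR⊆alternating (_ ∷ []) _ (s≤s ())
LRLR⊆alternating (_ ∷ _ ∷ []) _ (s≤s (s≤s ()))
LRLR⊆alternating (_ ∷ _ ∷ _ ∷ []) _ (s≤s (s≤s (s≤s ())))
LRLR⊆alternating (_ ∷ _ ∷ _ ∷ _ ∷ []) _ (s≤s (s≤s (s≤s (s≤s ()))))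

LRLR⊆L∷ : ∀ u {w} → Alternating u → 4 ≤ length u → u ⊆ L ∷ w → LRLR ⊆ L ∷ w
LRLR⊆L∷ (L ∷ R ∷ L ∷ R ∷ u) _ _ u⊆ = ⊆-trans (refl ∷ refl ∷ refl ∷ refl ∷ minimum u) u⊆
LRLR⊆L∷ (R ∷ L ∷ R ∷ L ∷ u) _ _ (L ∷ʳ u⊆w) = refl ∷ ⊆-trans (refl ∷ refl ∷ refl ∷ minimum (L ∷ u)) u⊆w
LRLR⊆L∷ (L ∷ L ∷ _) () _ _
LRLR⊆L∷ (R ∷ R ∷ _) () _ _
LRLR⊆L∷ (L ∷ R ∷ R ∷ _) () _ _
LRLR⊆L∷ (R ∷ L ∷ L ∷ _) () _ _
LRLR⊆L∷ (L ∷ R ∷ L ∷ L ∷ _) () _ _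
LRLR⊆L∷ (R ∷ L ∷ R ∷ R ∷ _) () _ _
LRLR⊆L∷ [] _ () _
LRLR⊆L∷ (_ ∷ []) _ (s≤s ()) _
LRLR⊆L∷ (_ ∷ _ ∷ []) _ (s≤s (s≤s ())) _
LRLR⊆L∷ (_ ∷ _ ∷ _ ∷ []) _ (s≤s (s≤s (s≤s ()))) _

altW≤4 : ∀ {w} → ¬ LRLR ⊆ w → altW w ≤ 4
altW≤4 LRLR⊈w = altW-≤ λ {u} u⊆w alternating → ℕ.≮⇒≥ λ 4<∣u∣ →
  LRLR⊈w (⊆-trans (LRLR⊆alternating u alternating 4<∣u∣) u⊆w)

altW≤3 : ∀ {x w} → x ≡ L → ¬ LRLR ⊆ x ∷ w → altW (x ∷ w) ≤ 3
altW≤3 refl LRLR⊈w = altW-≤ λ {u} u⊆w alternating → ℕ.≮⇒≥ λ 3<∣u∣ →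
  LRLR⊈w (LRLR⊆L∷ u alternating 3<∣u∣ u⊆w)

lookup-<⇔ : ∀ {n k} {v : Vec (Fin n) k} → Linked _<_ v →
  ∀ i j → (i < j ⇔ lookup v i < lookup v j)
lookup-<⇔ ascending i j = mk⇔ (lookup⁺ Fin.<-trans ascending) reflect
  where
  reflect : _ → i < j
  reflect vi<vj with Fin.<-cmp i j
  ... | tri< i<j _ _ = i<j
  ... | tri≈ _ refl _ = ⊥-elim (Fin.<-irrefl refl vi<vj)
  ... | tri> _ _ j<i = ⊥-elim (Fin.<-asym vi<vj (lookup⁺ Fin.<-trans ascending j<i))

contains-by-values : ∀ {n k} (π : Permutation′ n) (P : Vec (Fin k) k) (v : Vec (Fin n) k) →
  Linked _<_ v → Linked (_<_ on (π ⟨$⟩ˡ_)) (Vec.map (lookup v) P) → Contains π P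
contains-by-values π P v ascending positions =
  position , (λ i j → lookup⁺ Fin.<-trans positions) , order
  where
  position : Fin _ → Fin _
  position i = π ⟨$⟩ˡ lookup (Vec.map (lookup v) P) i
  value : ∀ i → π ⟨$⟩ʳ position i ≡ lookup v (lookup P i)
  value i = trans (inverseʳ π) (lookup-map i (lookup v) P)
  order : ∀ i j → (lookup P i < lookup P j) ⇔ ((π ⟨$⟩ʳ position i) < (π ⟨$⟩ʳ position j))
  order i j rewrite value i | value j = lookup-<⇔ ascending (lookup P i) (lookup P j)

⟨$⟩ˡ-injective : ∀ {n} (π : Permutation′ n) {i j} → π ⟨$⟩ˡ i ≡ π ⟨$⟩ˡ j → i ≡ j
⟨$⟩ˡ-injective π {i} {j} eq = trans (sym (inverseʳ π)) (trans (cong (π ⟨$⟩ʳ_) eq) (inverseʳ π))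

LRLR-values⇒pattern : ∀ {n} (π : Permutation′ n) {o a b c d : Fin n} →
  o < a → a < b → b < c → c < d →
  let pos = π ⟨$⟩ˡ_ in
  pos a < pos o → pos o < pos b → pos c < pos o → pos o < pos d →
  Contains π p3124 ⊎ Contains π p42153 ⊎ Contains π p24153
LRLR-values⇒pattern π {o} {a} {b} {c} {d} o<a a<b b<c c<d a◁o o◁b c◁o o◁d
  with Fin.<-cmp (π ⟨$⟩ˡ b) (π ⟨$⟩ˡ d)
... | tri< b◁d _ _ = inj₁ (contains-by-values π p3124 (o ∷ b ∷ c ∷ d ∷ [])
        (Fin.<-trans o<a a<b ∷ b<c ∷ c<d ∷ [-]) (c◁o ∷ o◁b ∷ b◁d ∷ [-]))
... | tri≈ _ b≡d _ = ⊥-elim (Fin.<-irrefl (⟨$⟩ˡ-injective π b≡d) (Fin.<-trans b<c c<d))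
... | tri> _ _ d◁b with Fin.<-cmp (π ⟨$⟩ˡ a) (π ⟨$⟩ˡ c)
...   | tri< a◁c _ _ = inj₂ (inj₂ (contains-by-values π p24153 (o ∷ a ∷ b ∷ c ∷ d ∷ [])
          (o<a ∷ a<b ∷ b<c ∷ c<d ∷ [-]) (a◁c ∷ c◁o ∷ o◁d ∷ d◁b ∷ [-])))
...   | tri≈ _ a≡c _ = ⊥-elim (Fin.<-irrefl (⟨$⟩ˡ-injective π a≡c) (Fin.<-trans a<b b<c))
...   | tri> _ _ c◁a = inj₂ (inj₁ (contains-by-values π p42153 (o ∷ a ∷ b ∷ c ∷ d ∷ [])
          (o<a ∷ a<b ∷ b<c ∷ c<d ∷ [-]) (c◁a ∷ a◁o ∷ o◁d ∷ d◁b ∷ [-])))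

letterAt-L⇒< : ∀ {n} {p q : Fin n} → letterAt p q ≡ L → p < q
letterAt-L⇒< {p = p} {q} _ with toℕ p <ᵇ toℕ q | ℕ.<ᵇ-reflects-< (toℕ p) (toℕ q)
letterAt-L⇒< refl | true | ofʸ p<q = p<q

letterAt-R⇒≮ : ∀ {n} {p q : Fin n} → letterAt p q ≡ R → ¬ p < q
letterAt-R⇒≮ {p = p} {q} _ with toℕ p <ᵇ toℕ q | ℕ.<ᵇ-reflects-< (toℕ p) (toℕ q)
letterAt-R⇒≮ refl | false | ofⁿ p≮q = p≮q

<⇒letterAt-L : ∀ {n} {p q : Fin n} → p < q → letterAt p q ≡ L
<⇒letterAt-L {p = p} {q} p<q with toℕ p <ᵇ toℕ q | ℕ.<ᵇ-reflects-< (toℕ p) (toℕ q)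
... | true | _ = refl
... | false | ofⁿ p≮q = ⊥-elim (p≮q p<q)

⊆-tabulate⁻ : ∀ {A : Set} {m} (g : Fin m → A) {u : List A} → u ⊆ Vec.toList (Vec.tabulate g) →
  Σ (Fin (length u) → Fin m) λ f → (∀ {i j} → i < j → f i < f j) × (∀ i → g (f i) ≡ List.lookup u i)
⊆-tabulate⁻ {m = zero} g [] = (λ ()) , (λ { {()} }) , λ ()
⊆-tabulate⁻ {m = suc m} g (_ ∷ʳ u⊆) with ⊆-tabulate⁻ (λ i → g (fs i)) u⊆
... | f , increasing , values = (λ i → fs (f i)) , (λ i<j → ℕ.s<s (increasing i<j)) , values
⊆-tabulate⁻ {m = suc m} g {_ ∷ u} (refl ∷ u⊆) with ⊆-tabulate⁻ (λ i → g (fs i)) u⊆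
... | f , increasing , values = f′ , increasing′ , values′
  where
  f′ : Fin (suc (length u)) → Fin (suc m)
  f′ fz = fz
  f′ (fs i) = fs (f i)
  increasing′ : ∀ {i j} → i < j → f′ i < f′ j
  increasing′ {fz} {fs j} _ = ℕ.z<s
  increasing′ {fs i} {fs j} i<j = ℕ.s<s (increasing (ℕ.s<s⁻¹ i<j))
  values′ : ∀ i → g (f′ i) ≡ List.lookup (g fz ∷ u) i
  values′ fz = refl
  values′ (fs i) = values i

letterAt-R⇒right-of-min : ∀ {m} (π : Permutation′ (suc m)) {i} →
  letterAt (π ⟨$⟩ˡ fs i) (π ⟨$⟩ˡ fz) ≡ R → π ⟨$⟩ˡ fz < π ⟨$⟩ˡ fs i
letterAt-R⇒right-of-min π isR =
  Fin.≤∧≢⇒< (ℕ.≮⇒≥ (letterAt-R⇒≮ isR)) (λ eq → Fin.0≢1+n (⟨$⟩ˡ-injective π eq))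

LRLR⊆word⇒pattern : ∀ {m} (π : Permutation′ (suc m)) → LRLR ⊆ word π →
  Contains π p3124 ⊎ Contains π p42153 ⊎ Contains π p24153
LRLR⊆word⇒pattern π LRLR⊆w with ⊆-tabulate⁻ _ LRLR⊆w
... | f , increasing , letters =
  LRLR-values⇒pattern π {fz} {fs (f 0F)} {fs (f 1F)} {fs (f 2F)} {fs (f 3F)}
    ℕ.z<s (ℕ.s<s (increasing ℕ.z<s)) (ℕ.s<s (increasing (ℕ.s<s ℕ.z<s)))
    (ℕ.s<s (increasing (ℕ.s<s (ℕ.s<s ℕ.z<s))))
    (letterAt-L⇒< (letters 0F)) (letterAt-R⇒right-of-min π (letters 1F))
    (letterAt-L⇒< (letters 2F)) (letterAt-R⇒right-of-min π (letters 3F))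

mainTheorem3 : (m : ℕ) (π : Permutation′ (suc (suc m)))
    → Avoids π p3124 → Avoids π p42153 → Avoids π p24153
    → ¬ IsSubword (L ∷ R ∷ L ∷ R ∷ []) (word π)
      × alt π ≤ 4
      × ((π ⟨$⟩ˡ fs fz) < (π ⟨$⟩ˡ fz) → alt π ≤ 3)
mainTheorem3 m π avoids3124 avoids42153 avoids24153 =
  LRLR⊈w ∘ ∈-subwords⇒⊆ (word π) , altW≤4 LRLR⊈w , alt≤3
  where
  LRLR⊈w : ¬ LRLR ⊆ word π
  LRLR⊈w = [ avoids3124 , [ avoids42153 , avoids24153 ] ] ∘ LRLR⊆word⇒pattern π
  alt≤3 : (π ⟨$⟩ˡ fs fz) < (π ⟨$⟩ˡ fz) → alt π ≤ 3
  alt≤3 2◁1 = altW≤3 (<⇒letterAt-L 2◁1) LRLR⊈w
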